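{- Let $\ell\ge2$ be an integer and $d=2^\ell-1$. Then the $d$-dimensional hypercube $Q_d$ has a spanning $2$-connected subgraph $H$ with $\mathsf{tvc}(H)\le 2\cdot\left(2^{d-\ell}+2^{d/2-\ell}\right)$.
   Context: The hypercube $Q_d$ has vertex set $\{0,1\}^d$, two vertices adjacent iff they differ in exactly one coordinate. A total vertex cover of a graph $H$ is a set $S\subseteq V(H)$ that is a vertex cover of $H$ and such that every vertex of $H$ has a neighbor in $S$; $\mathsf{tvc}(H)$ is its minimum size. -}

module Defs where

open import Data.Bool using (Bool)
open import Data.Nat using (ℕ; _<_; _≤_)
open import Data.Nat using (_^_)
open import Data.Fin using (Fin)
open import Data.Vec using (Vec; lookup)
open import Data.List using (List; length)
open import Data.List.Membership.Propositional using (_∈_)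
open import Data.Product using (Σ; ∃; _×_; _,_)
open import Data.Sum using (_⊎_)
open import Relation.Nullary using (¬_)
open import Relation.Binary.PropositionalEquality using (_≡_; _≢_)
open import Data.Unit using (⊤)

Vertex : ℕ → Set
Vertex d = Vec Bool d

QAdj : (d : ℕ) → Vertex d → Vertex d → Set
QAdj d x y = Σ (Fin d) λ i → (lookup x i ≢ lookup y i) ×
               ((j : Fin d) → j ≢ i → lookup x j ≡ lookup y j)

record SpanningSubgraph (d : ℕ) : Set₁ where
  field
    Edge    : Vertex d → Vertex d → Set
    sym     : ∀ {u v} → Edge u v → Edge v u
    ⊆Q      : ∀ {u v} → Edge u v → QAdj d u v
open SpanningSubgraph public

data Walk {d : ℕ} (H : SpanningSubgraph d) (P : Vertex d → Set)
     : Vertex d → Vertex d → Set where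
  here  : ∀ {u} → P u → Walk H P u u
  step  : ∀ {u v w} → P u → Edge H u v → Walk H P v w → Walk H P u w

Connected : {d : ℕ} → SpanningSubgraph d → Set
Connected {d} H = (u w : Vertex d) → Walk H (λ _ → ⊤) u w

TwoConnected : {d : ℕ} → SpanningSubgraph d → Set
TwoConnected {d} H =
  (2 < 2 ^ d) × Connected H ×
  ((v u w : Vertex d) → u ≢ v → w ≢ v → Walk H (λ x → x ≢ v) u w)

IsTotalVertexCover : {d : ℕ} → SpanningSubgraph d → List (Vertex d) → Set
IsTotalVertexCover {d} H S =
  ((u v : Vertex d) → Edge H u v → (u ∈ S ⊎ v ∈ S)) ×
  ((v : Vertex d) → Σ (Vertex d) λ u → (u ∈ S) × Edge H v u)

-- tvc(H) ≤ k  iff  some total vertex cover has at most k elements.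
-- (Duplicates in the list only increase its length.)
TVC≤ : {d : ℕ} → SpanningSubgraph d → ℕ → Set
TVC≤ {d} H k = Σ (List (Vertex d)) λ S → IsTotalVertexCover H S × (length S ≤ k)

{-# OPTIONS --safe #-}
-- Put d(k) = 2^(k+1) − 1, so d(k+1) = 2 d(k) + 1 and a vertex of Q_d(k+1) is a triple
-- ⟨ a , b , p ⟩ with a, b ∈ Q_d(k) and a bit p.  Starting from S(0) = Q_1, let S(k+1) consist
-- of the vertices ⟨ a , a ⊕ w , parity a ⊕ [w = 1] ⟩ with a arbitrary and w ∈ S(k) (the
-- (u ∣ u + v) doubling of codes); then |S(k)| = 2^(d − ℓ + 1) for ℓ = k + 1, which is within
-- the bound.  Let H be the set of cube edges meeting S, so S covers H by construction.  By
-- induction S is totally dominating, every vertex outside S has two neighbours in S, and H − v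
-- is connected for every v.  For the last point, in layer a (first block a) the vertices
-- ⟨ a , a ⊕ w , parity a ⟩ with w ≠ 1 form a copy of H(k) − 1 rooted at ⟨ a , a , parity a ⟩,
-- every other vertex reaches such a copy in at most two steps, the copy of 1 (whose parity bit
-- is flipped) joins the roots of adjacent layers, and H(k) − a₀ then connects every layer
-- other than the layer a₀ of v.
module Submission where

open import Defs hiding (sym)
open import Data.Bool using (Bool; true; false; not; _∧_; _xor_)
open import Data.Bool.Properties
  using (not-¬; ¬-not; not-involutive; not-distribˡ-xor; not-distribʳ-xor;
         xor-same; xor-comm; xor-assoc; xor-identityʳ)
  renaming (_≟_ to _≟ᵇ_)
open import Data.Empty using (⊥-elim)
open import Data.Fin using () renaming (zero to fzero; suc to fsuc)
open import Data.List using (List; []; _∷_; map; length; cartesianProduct; cartesianProductWith)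
open import Data.List.Properties using (length-++; length-map)
open import Data.List.Membership.Propositional using (_∈_)
open import Data.List.Membership.Propositional.Properties
  using (∈-map⁺; ∈-cartesianProductWith⁺; ∈-cartesianProduct⁺)
open import Data.List.Relation.Unary.Any using (here; there)
open import Data.Nat using (ℕ; zero; suc; _+_; _*_; _∸_; _^_; _≤_; _<_; z≤n; s≤s)
open import Data.Nat.Properties
  using (^-distribˡ-+-*; ^-monoʳ-<; ≤-refl; ≤-reflexive; ≤-trans; m≤n+m; +-mono-≤;
         +-comm; +-assoc; +-suc; +-identityʳ; m+n∸n≡m; n∸n≡0)
open import Data.Product using (Σ; _×_; _,_; proj₁; proj₂)
open import Data.Sum using (_⊎_; inj₁; inj₂)
open import Data.Unit using (⊤; tt)
open import Data.Vec using (Vec; []; _∷_; _++_)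
import Data.Vec as Vec
open import Data.Vec.Properties using (++-injectiveˡ; ++-injectiveʳ)
open import Function using (case_of_)
open import Relation.Nullary using (Dec; yes; no; does)
open import Relation.Nullary.Decidable using (dec-true; dec-false)
open import Relation.Binary.PropositionalEquality

dim : ℕ → ℕ
dim zero    = 1
dim (suc k) = dim k + (dim k + 1)

-- Cube k is Q_(dim k); flatten below identifies it with Vertex (dim k).
data Cube : ℕ → Set where
  bit     : Bool → Cube zero
  ⟨_,_,_⟩ : ∀ {k} → Cube k → Cube k → Bool → Cube (suc k)

variable
  k : ℕ

zeros ones : Cube k
zeros {zero}  = bit false
zeros {suc k} = ⟨ zeros , zeros , false ⟩
ones {zero}  = bit true
ones {suc k} = ⟨ ones , ones , true ⟩

infixl 6 _⊕_
_⊕_ : Cube k → Cube k → Cube k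
bit x ⊕ bit y = bit (x xor y)
⟨ a , b , p ⟩ ⊕ ⟨ a' , b' , p' ⟩ = ⟨ a ⊕ a' , b ⊕ b' , p xor p' ⟩

parity : Cube k → Bool
parity (bit x)       = x
parity ⟨ a , b , p ⟩ = parity a xor parity b xor p

layer : Cube (suc k) → Cube k
layer ⟨ a , _ , _ ⟩ = a

infix 4 _≟ᶜ_
_≟ᶜ_ : (x y : Cube k) → Dec (x ≡ y)
bit x ≟ᶜ bit y with x ≟ᵇ y
... | yes refl = yes refl
... | no x≢y   = no λ { refl → x≢y refl }
⟨ a , b , p ⟩ ≟ᶜ ⟨ a' , b' , p' ⟩ with a ≟ᶜ a' | b ≟ᶜ b' | p ≟ᵇ p'
... | yes refl | yes refl | yes refl = yes refl
... | no a≢a'  | _        | _        = no λ { refl → a≢a' refl }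
... | yes _    | no b≢b'  | _        = no λ { refl → b≢b' refl }
... | yes _    | yes _    | no p≢p'  = no λ { refl → p≢p' refl }

zeros≢ones : zeros {k} ≢ ones
zeros≢ones {zero}  ()
zeros≢ones {suc k} ()

⟨⟩-cong : ∀ {a a' b b' : Cube k} {p p'} →
          a ≡ a' → b ≡ b' → p ≡ p' → ⟨ a , b , p ⟩ ≡ ⟨ a' , b' , p' ⟩
⟨⟩-cong refl refl refl = refl

⊕-comm : (x y : Cube k) → x ⊕ y ≡ y ⊕ x
⊕-comm (bit x) (bit y) = cong bit (xor-comm x y)
⊕-comm ⟨ a , b , p ⟩ ⟨ a' , b' , p' ⟩ =
  ⟨⟩-cong (⊕-comm a a') (⊕-comm b b') (xor-comm p p')

⊕-assoc : (x y z : Cube k) → x ⊕ y ⊕ z ≡ x ⊕ (y ⊕ z)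
⊕-assoc (bit x) (bit y) (bit z) = cong bit (xor-assoc x y z)
⊕-assoc ⟨ a , b , p ⟩ ⟨ a' , b' , p' ⟩ ⟨ a″ , b″ , p″ ⟩ =
  ⟨⟩-cong (⊕-assoc a a' a″) (⊕-assoc b b' b″) (xor-assoc p p' p″)

⊕-self : (x : Cube k) → x ⊕ x ≡ zeros
⊕-self (bit x)       = cong bit (xor-same x)
⊕-self ⟨ a , b , p ⟩ = ⟨⟩-cong (⊕-self a) (⊕-self b) (xor-same p)

⊕-identityʳ : (x : Cube k) → x ⊕ zeros ≡ x
⊕-identityʳ (bit x)       = cong bit (xor-identityʳ x)
⊕-identityʳ ⟨ a , b , p ⟩ = ⟨⟩-cong (⊕-identityʳ a) (⊕-identityʳ b) (xor-identityʳ p)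

⊕-cancelʳ : (x y : Cube k) → x ⊕ y ⊕ y ≡ x
⊕-cancelʳ x y = begin
  x ⊕ y ⊕ y   ≡⟨ ⊕-assoc x y y ⟩
  x ⊕ (y ⊕ y) ≡⟨ cong (x ⊕_) (⊕-self y) ⟩
  x ⊕ zeros   ≡⟨ ⊕-identityʳ x ⟩
  x           ∎
  where open ≡-Reasoning

⊕-cancelˡ : (x y : Cube k) → x ⊕ (x ⊕ y) ≡ y
⊕-cancelˡ x y = begin
  x ⊕ (x ⊕ y) ≡⟨ cong (x ⊕_) (⊕-comm x y) ⟩
  x ⊕ (y ⊕ x) ≡⟨ ⊕-assoc x y x ⟨
  x ⊕ y ⊕ x   ≡⟨ cong (_⊕ x) (⊕-comm x y) ⟩
  y ⊕ x ⊕ x   ≡⟨ ⊕-cancelʳ y x ⟩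
  y           ∎
  where open ≡-Reasoning

⊕-injectiveʳ : {x y : Cube k} (z : Cube k) → x ⊕ z ≡ y ⊕ z → x ≡ y
⊕-injectiveʳ {x = x} {y} z eq =
  trans (sym (⊕-cancelʳ x z)) (trans (cong (_⊕ z) eq) (⊕-cancelʳ y z))

data Adj : Cube k → Cube k → Set where
  flip₀ : ∀ {x} → Adj (bit x) (bit (not x))
  left  : ∀ {a a' b : Cube k} {p} → Adj a a' → Adj ⟨ a , b , p ⟩ ⟨ a' , b , p ⟩
  right : ∀ {a b b' : Cube k} {p} → Adj b b' → Adj ⟨ a , b , p ⟩ ⟨ a , b' , p ⟩
  flip  : ∀ {a b : Cube k} {p} → Adj ⟨ a , b , p ⟩ ⟨ a , b , not p ⟩

Adj-sym : {x y : Cube k} → Adj x y → Adj y x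
Adj-sym (flip₀ {x}) = subst (λ y → Adj (bit (not x)) (bit y)) (not-involutive x) flip₀
Adj-sym (left h)  = left (Adj-sym h)
Adj-sym (right h) = right (Adj-sym h)
Adj-sym (flip {a = a} {b} {p}) =
  subst (λ q → Adj ⟨ a , b , not p ⟩ ⟨ a , b , q ⟩) (not-involutive p) flip

Adj⇒≢ : {x y : Cube k} → Adj x y → x ≢ y
Adj⇒≢ flip₀     eq = not-¬ refl (cong (λ { (bit x) → x }) eq)
Adj⇒≢ (left h)  eq = Adj⇒≢ h (cong layer eq)
Adj⇒≢ (right h) eq = Adj⇒≢ h (cong (λ { ⟨ _ , b , _ ⟩ → b }) eq)
Adj⇒≢ flip      eq = not-¬ refl (cong (λ { ⟨ _ , _ , p ⟩ → p }) eq)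

Adj-⊕ʳ : {x y : Cube k} (z : Cube k) → Adj x y → Adj (x ⊕ z) (y ⊕ z)
Adj-⊕ʳ {x = bit x} (bit z) flip₀ =
  subst (λ q → Adj (bit (x xor z)) (bit q)) (not-distribˡ-xor x z) flip₀
Adj-⊕ʳ ⟨ _ , _ , _ ⟩ (left h)  = left (Adj-⊕ʳ _ h)
Adj-⊕ʳ ⟨ _ , _ , _ ⟩ (right h) = right (Adj-⊕ʳ _ h)
Adj-⊕ʳ {x = ⟨ a , b , p ⟩} ⟨ c , d , r ⟩ flip =
  subst (λ q → Adj ⟨ a ⊕ c , b ⊕ d , p xor r ⟩ ⟨ a ⊕ c , b ⊕ d , q ⟩)
        (not-distribˡ-xor p r) flip

Adj-⊕ˡ : {x y : Cube k} (z : Cube k) → Adj x y → Adj (z ⊕ x) (z ⊕ y)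
Adj-⊕ˡ {x = x} {y} z h = subst₂ Adj (⊕-comm x z) (⊕-comm y z) (Adj-⊕ʳ z h)

parity-Adj : {x y : Cube k} → Adj x y → parity y ≡ not (parity x)
parity-Adj flip₀ = refl
parity-Adj {x = ⟨ a , b , p ⟩} (left h) rewrite parity-Adj h =
  sym (not-distribˡ-xor (parity a) (parity b xor p))
parity-Adj {x = ⟨ a , b , p ⟩} (right h) rewrite parity-Adj h =
  trans (cong (parity a xor_) (sym (not-distribˡ-xor (parity b) p)))
        (sym (not-distribʳ-xor (parity a) (parity b xor p)))
parity-Adj {x = ⟨ a , b , p ⟩} flip =
  trans (cong (parity a xor_) (sym (not-distribʳ-xor (parity b) p)))
        (sym (not-distribʳ-xor (parity a) (parity b xor p)))

Adj-across : {a b w : Cube k} → Adj (a ⊕ b) w → Adj a (w ⊕ b)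
Adj-across {a = a} {b} h = subst (λ z → Adj z _) (⊕-cancelʳ a b) (Adj-⊕ʳ b h)

parity-zeros : parity (zeros {k}) ≡ false
parity-zeros {zero}  = refl
parity-zeros {suc k} rewrite parity-zeros {k} = refl

parity-ones : parity (ones {k}) ≡ true
parity-ones {zero}  = refl
parity-ones {suc k} rewrite parity-ones {k} = refl

data WalkIn {X : Set} (E : X → X → Set) (P : X → Set) : X → X → Set where
  done : ∀ {x} → P x → WalkIn E P x x
  move : ∀ {x y z} → P x → E x y → WalkIn E P y z → WalkIn E P x z

module _ {X : Set} {E : X → X → Set} {P : X → Set} where

  start : ∀ {x y} → WalkIn E P x y → P x
  start (done px)     = px
  start (move px _ _) = px

  infixr 5 _++ᵂ_
  _++ᵂ_ : ∀ {x y z} → WalkIn E P x y → WalkIn E P y z → WalkIn E P x z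
  done _       ++ᵂ w' = w'
  move px e w  ++ᵂ w' = move px e (w ++ᵂ w')

  reverseᵂ : (∀ {u v} → E u v → E v u) → ∀ {x y} → WalkIn E P x y → WalkIn E P y x
  reverseᵂ sym-E (done px)    = done px
  reverseᵂ sym-E (move px e w) = reverseᵂ sym-E w ++ᵂ move (start w) (sym-E e) (done px)

  mapᵂ : ∀ {Q : X → Set} → (∀ {u} → P u → Q u) → ∀ {x y} → WalkIn E P x y → WalkIn E Q x y
  mapᵂ f (done px)     = done (f px)
  mapᵂ f (move px e w) = move (f px) e (mapᵂ f w)

bindᵂ : ∀ {X Y : Set} {E : X → X → Set} {P : X → Set} {F : Y → Y → Set} {Q : Y → Set}
        (f : X → Y) → (∀ {u} → P u → Q (f u)) →
        (∀ {u v} → P u → P v → E u v → WalkIn F Q (f u) (f v)) →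
        ∀ {x y} → WalkIn E P x y → WalkIn F Q (f x) (f y)
bindᵂ f fP fE (done px)     = done (fP px)
bindᵂ f fP fE (move px e w) = fE px (start w) e ++ᵂ bindᵂ f fP fE w

CoverEdge : (Cube k → Bool) → Cube k → Cube k → Set
CoverEdge S x y = Adj x y × (S x ≡ true ⊎ S y ≡ true)

CoverEdge-sym : ∀ {S : Cube k → Bool} {x y} → CoverEdge S x y → CoverEdge S y x
CoverEdge-sym (h , inj₁ Sx) = Adj-sym h , inj₂ Sx
CoverEdge-sym (h , inj₂ Sy) = Adj-sym h , inj₁ Sy

NeighbourIn : (Cube k → Bool) → Cube k → Set
NeighbourIn {k} S x = Σ (Cube k) λ y → Adj x y × S y ≡ true

record Admissible (k : ℕ) (S : Cube k → Bool) : Set where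
  field
    zeros∈           : S zeros ≡ true
    ones∈            : S ones ≡ true
    dominating       : ∀ x → NeighbourIn S x
    doublyDominating : ∀ x → S x ≡ false →
                       Σ (NeighbourIn S x) λ (y , _) → Σ (NeighbourIn S x) λ (y' , _) → y ≢ y'
    noCutVertex      : ∀ v x y → x ≢ v → y ≢ v → WalkIn (CoverEdge S) (_≢ v) x y

admissible₀ : Admissible zero (λ _ → true)
admissible₀ = record
  { zeros∈           = refl
  ; ones∈            = refl
  ; dominating       = λ { (bit x) → bit (not x) , flip₀ , refl }
  ; doublyDominating = λ _ ()
  ; noCutVertex      = noCutVertex
  }
  where
  noCutVertex : ∀ v x y → x ≢ v → y ≢ v → WalkIn (CoverEdge (λ _ → true)) (_≢ v) x y
  noCutVertex (bit v) (bit x) (bit y) x≢v y≢v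
    with refl ← ¬-not (λ x≡v → x≢v (cong bit x≡v))
       | refl ← ¬-not (λ y≡v → y≢v (cong bit y≡v)) = done x≢v

connected : ∀ {S : Cube k → Bool} → Admissible k S → ∀ x y → WalkIn (CoverEdge S) (λ _ → ⊤) x y
connected adm x y with x ≟ᶜ y
... | yes refl = done tt
... | no x≢y with Admissible.dominating adm x
...   | z , x~z , Sz with z ≟ᶜ y
...     | yes refl = move tt (x~z , inj₂ Sz) (done tt)
...     | no z≢y   =
          move tt (x~z , inj₂ Sz)
            (mapᵂ (λ _ → tt) (Admissible.noCutVertex adm x z y (λ z≡x → Adj⇒≢ x~z (sym z≡x))
                                                                (λ y≡x → x≢y (sym y≡x))))

-- The doubling step

checkBit : Cube k → Cube k → Bool
checkBit a w = parity a xor does (w ≟ᶜ ones)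

double : (Cube k → Bool) → Cube (suc k) → Bool
double S ⟨ a , b , p ⟩ = S (a ⊕ b) ∧ does (p ≟ᵇ checkBit a (a ⊕ b))

checkBit-ones : (a : Cube k) → checkBit a ones ≡ not (parity a)
checkBit-ones {k} a rewrite dec-true (ones {k} ≟ᶜ ones) refl = xor-comm (parity a) true

checkBit-≢ones : (a : Cube k) {w : Cube k} → w ≢ ones → checkBit a w ≡ parity a
checkBit-≢ones a {w} w≢1 rewrite dec-false (w ≟ᶜ ones) w≢1 = xor-identityʳ (parity a)

module DoubleMembership {k} (S : Cube k → Bool) where

  double-intro : ∀ {a b p w} → a ⊕ b ≡ w → S w ≡ true → p ≡ checkBit a w →
                 double S ⟨ a , b , p ⟩ ≡ true
  double-intro {a} {b} refl Sw refl rewrite Sw = dec-true (checkBit a (a ⊕ b) ≟ᵇ _) refl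

  double-elim : ∀ {a b p} → double S ⟨ a , b , p ⟩ ≡ true →
                S (a ⊕ b) ≡ true × p ≡ checkBit a (a ⊕ b)
  double-elim {a} {b} {p} with S (a ⊕ b) | p ≟ᵇ checkBit a (a ⊕ b)
  ... | true | yes p≡c = λ _ → refl , p≡c

  double-flip : ∀ {a b p} → S (a ⊕ b) ≡ true → double S ⟨ a , b , p ⟩ ≡ false →
                double S ⟨ a , b , not p ⟩ ≡ true
  double-flip {a} {b} {p} Sw ∉ =
    double-intro refl Sw (trans (cong not (¬-not p≢c)) (not-involutive _))
    where
    p≢c : p ≢ checkBit a (a ⊕ b)
    p≢c p≡c = case trans (sym (double-intro refl Sw p≡c)) ∉ of λ ()

  double-right : ∀ {a w p} → S w ≡ true → p ≡ checkBit a w → double S ⟨ a , a ⊕ w , p ⟩ ≡ true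
  double-right {a} {w} = double-intro (⊕-cancelˡ a w)

  double-left : ∀ {a b w p} → Adj (a ⊕ b) w → S w ≡ true → p ≡ not (checkBit a w) →
                double S ⟨ w ⊕ b , b , p ⟩ ≡ true
  double-left {a} {b} {w} {p} h Sw p≡ = double-intro (⊕-cancelʳ w b) Sw (begin
    p                                     ≡⟨ p≡ ⟩
    not (parity a xor does (w ≟ᶜ ones))   ≡⟨ not-distribˡ-xor (parity a) _ ⟩
    not (parity a) xor does (w ≟ᶜ ones)   ≡⟨ cong (_xor _) (parity-Adj (Adj-across h)) ⟨
    parity (w ⊕ b) xor does (w ≟ᶜ ones)   ∎)
    where open ≡-Reasoning

  flip-covered : ∀ {a b p} → S (a ⊕ b) ≡ true → CoverEdge (double S) ⟨ a , b , p ⟩ ⟨ a , b , not p ⟩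
  flip-covered {a} {b} {p} Sw with double S ⟨ a , b , p ⟩ in ∈?
  ... | true  = flip , inj₁ refl
  ... | false = flip , inj₂ (double-flip {p = p} Sw ∈?)

embed : Cube k → Cube k → Cube (suc k)
embed a w = ⟨ a , a ⊕ w , parity a ⟩

root : Cube k → Cube (suc k)
root a = embed a zeros

diff : Cube (suc k) → Cube k
diff ⟨ a , b , _ ⟩ = a ⊕ b

Adj-diffˡ : ∀ {a b w : Cube k} {p} → Adj (a ⊕ b) w → Adj ⟨ a , b , p ⟩ ⟨ w ⊕ b , b , p ⟩
Adj-diffˡ h = left (Adj-across h)

Adj-diffʳ : ∀ {a b w : Cube k} {p} → Adj (a ⊕ b) w → Adj ⟨ a , b , p ⟩ ⟨ a , a ⊕ w , p ⟩
Adj-diffʳ {a = a} {b} h = right (subst (λ z → Adj z _) (⊕-cancelˡ a b) (Adj-⊕ˡ a h))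

module Doubling {k} {S : Cube k → Bool} (adm : Admissible k S) where
  open Admissible adm
  open DoubleMembership S

  S⁺ : Cube (suc k) → Bool
  S⁺ = double S

  E⁺ : Cube (suc k) → Cube (suc k) → Set
  E⁺ = CoverEdge S⁺

  liftNeighbour : ∀ x {w} → Adj (diff x) w → S w ≡ true →
                  Σ (NeighbourIn S⁺ x) λ (y , _) → diff y ≡ w
  liftNeighbour ⟨ a , b , p ⟩ {w} h Sw with p ≟ᵇ checkBit a w
  ... | yes p≡c = (⟨ a , a ⊕ w , p ⟩ , Adj-diffʳ h , double-right Sw p≡c) , ⊕-cancelˡ a w
  ... | no p≢c  = (⟨ w ⊕ b , b , p ⟩ , Adj-diffˡ h , double-left h Sw (¬-not p≢c)) , ⊕-cancelʳ w b

  zeros∈⁺ : S⁺ zeros ≡ true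
  zeros∈⁺ = double-intro (⊕-self (zeros {k})) zeros∈
    (sym (trans (checkBit-≢ones (zeros {k}) zeros≢ones) (parity-zeros {k})))

  ones∈⁺ : S⁺ ones ≡ true
  ones∈⁺ = double-intro (⊕-self (ones {k})) zeros∈
    (sym (trans (checkBit-≢ones (ones {k}) zeros≢ones) (parity-ones {k})))

  dominating⁺ : ∀ x → NeighbourIn S⁺ x
  dominating⁺ x with dominating (diff x)
  ... | w , h , Sw = proj₁ (liftNeighbour x h Sw)

  doublyDominating⁺ : ∀ x → S⁺ x ≡ false →
                      Σ (NeighbourIn S⁺ x) λ (y , _) → Σ (NeighbourIn S⁺ x) λ (y' , _) → y ≢ y'
  doublyDominating⁺ x@(⟨ a , b , p ⟩) ∉ with S (a ⊕ b) ≟ᵇ true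
  ... | yes Sw with dominating (a ⊕ b)
  ...   | w , h , Sw' with liftNeighbour x h Sw'
  ...     | y , diff≡w = (⟨ a , b , not p ⟩ , flip , double-flip {p = p} Sw ∉) , y ,
                         λ eq → Adj⇒≢ h (trans (cong diff eq) diff≡w)
  doublyDominating⁺ x@(⟨ a , b , p ⟩) ∉ | no S≢true with doublyDominating (a ⊕ b) (¬-not S≢true)
  ... | (w₁ , h₁ , S₁) , (w₂ , h₂ , S₂) , w₁≢w₂
      with liftNeighbour x h₁ S₁ | liftNeighbour x h₂ S₂
  ...   | y₁ , diff≡w₁ | y₂ , diff≡w₂ =
          y₁ , y₂ , λ eq → w₁≢w₂ (trans (sym diff≡w₁) (trans (cong diff eq) diff≡w₂))

  InLayer : Cube k → Cube (suc k) → Set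
  InLayer a x = layer x ≡ a

  embed∈ : ∀ a {w} → w ≢ ones → S w ≡ true → S⁺ (embed a w) ≡ true
  embed∈ a w≢1 Sw = double-right Sw (sym (checkBit-≢ones a w≢1))

  embed-CoverEdge : ∀ a {w w'} → w ≢ ones → w' ≢ ones → CoverEdge S w w' →
                    E⁺ (embed a w) (embed a w')
  embed-CoverEdge a w≢1 _    (h , inj₁ Sw)  = right (Adj-⊕ˡ a h) , inj₁ (embed∈ a w≢1 Sw)
  embed-CoverEdge a _   w'≢1 (h , inj₂ Sw') = right (Adj-⊕ˡ a h) , inj₂ (embed∈ a w'≢1 Sw')

  -- Off ones, embed a keeps membership in S, so it carries H_S − ones into layer a.
  embed→root-≢ones : ∀ a {w} → w ≢ ones → WalkIn E⁺ (InLayer a) (embed a w) (root a)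
  embed→root-≢ones a w≢1 =
    bindᵂ (embed a) (λ _ → refl)
          (λ u≢1 v≢1 e → move refl (embed-CoverEdge a u≢1 v≢1 e) (done refl))
          (noCutVertex ones _ zeros w≢1 zeros≢ones)

  embed→root : ∀ a w → WalkIn E⁺ (InLayer a) (embed a w) (root a)
  embed→root a w with w ≟ᶜ ones
  ... | no w≢1 = embed→root-≢ones a w≢1
  ... | yes refl with dominating ones
  ...   | s , h , Ss =
          move refl (right (Adj-⊕ˡ a h) , inj₂ (embed∈ a s≢1 Ss)) (embed→root-≢ones a s≢1)
    where
    s≢1 : s ≢ ones
    s≢1 s≡1 = Adj⇒≢ h (sym s≡1)

  layer→root : ∀ a b {p} → p ≡ parity a → WalkIn E⁺ (InLayer a) ⟨ a , b , p ⟩ (root a)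
  layer→root a b refl =
    subst (λ z → WalkIn E⁺ (InLayer a) ⟨ a , z , parity a ⟩ (root a)) (⊕-cancelˡ a b)
          (embed→root a (a ⊕ b))

  -- The parity bit of link a is parity a' for every neighbour a' of a: it bridges adjacent layers.
  link : Cube k → Cube (suc k)
  link a = ⟨ a , a ⊕ ones , not (parity a) ⟩

  link∈ : ∀ a → S⁺ (link a) ≡ true
  link∈ a = double-right ones∈ (sym (checkBit-ones a))

  module AvoidingLayer (a₀ : Cube k) where

    Outside : Cube (suc k) → Set
    Outside x = layer x ≢ a₀

    ReachesRoot : Cube (suc k) → Set
    ReachesRoot x = Σ (Cube k) λ a → a ≢ a₀ × WalkIn E⁺ Outside x (root a)

    fromLayer : ∀ {a x y} → a ≢ a₀ → WalkIn E⁺ (InLayer a) x y → WalkIn E⁺ Outside x y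
    fromLayer a≢a₀ = mapᵂ λ x∈a x∈a₀ → a≢a₀ (trans (sym x∈a) x∈a₀)

    prepend : ∀ {x y} → Outside x → E⁺ x y → ReachesRoot y → ReachesRoot x
    prepend out e (a , a≢a₀ , walk) = a , a≢a₀ , move out e walk

    viaFlip : ∀ {a b p} → a ≢ a₀ → not p ≡ parity a → S (a ⊕ b) ≡ true → ReachesRoot ⟨ a , b , p ⟩
    viaFlip {a} {b} a≢a₀ p̄≡ Sw =
      a , a≢a₀ , move a≢a₀ (flip-covered Sw) (fromLayer a≢a₀ (layer→root a b p̄≡))

    viaNeighbour : ∀ {a b w} → a ≢ a₀ → Adj (a ⊕ b) w → S w ≡ true → w ⊕ b ≢ a₀ →
                   ReachesRoot ⟨ a , b , not (parity a) ⟩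
    viaNeighbour {a} {b} {w} a≢a₀ h Sw w⊕b≢a₀ with w ≟ᶜ ones
    ... | yes refl =
      prepend a≢a₀ (Adj-diffʳ h , inj₂ (link∈ a))
              (viaFlip a≢a₀ (not-involutive (parity a))
                       (subst (λ z → S z ≡ true) (sym (⊕-cancelˡ a ones)) ones∈))
    ... | no w≢1 =
      w ⊕ b , w⊕b≢a₀ ,
      move a≢a₀ (Adj-diffˡ h , inj₂ (double-left h Sw (cong not (sym (checkBit-≢ones a w≢1)))))
           (fromLayer w⊕b≢a₀ (layer→root (w ⊕ b) b (sym (parity-Adj (Adj-across h)))))

    offParity : ∀ {a b} → a ≢ a₀ → ReachesRoot ⟨ a , b , not (parity a) ⟩
    offParity {a} {b} a≢a₀ with S (a ⊕ b) in Sw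
    ... | true  = viaFlip a≢a₀ (not-involutive (parity a)) Sw
    ... | false with doublyDominating (a ⊕ b) Sw
    ...   | (w₁ , h₁ , S₁) , (w₂ , h₂ , S₂) , w₁≢w₂ with w₁ ⊕ b ≟ᶜ a₀
    ...     | no w₁⊕b≢a₀ = viaNeighbour a≢a₀ h₁ S₁ w₁⊕b≢a₀
    ...     | yes w₁⊕b≡a₀ = viaNeighbour a≢a₀ h₂ S₂ λ w₂⊕b≡a₀ →
                              w₁≢w₂ (⊕-injectiveʳ b (trans w₁⊕b≡a₀ (sym w₂⊕b≡a₀)))

    reachRoot : ∀ x → Outside x → ReachesRoot x
    reachRoot ⟨ a , b , p ⟩ a≢a₀ with p ≟ᵇ parity a
    ... | yes p≡ = a , a≢a₀ , fromLayer a≢a₀ (layer→root a b p≡)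
    ... | no p≢ with refl ← ¬-not p≢ = offParity a≢a₀

    rootsLinked : ∀ {a a'} → a ≢ a₀ → a' ≢ a₀ → Adj a a' → WalkIn E⁺ Outside (root a) (root a')
    rootsLinked {a} {a'} a≢a₀ a'≢a₀ h =
      fromLayer a≢a₀ (reverseᵂ CoverEdge-sym (embed→root a ones)) ++ᵂ
      move a≢a₀ (flip , inj₂ (link∈ a))
        (move a≢a₀ (left h , inj₁ (link∈ a))
          (fromLayer a'≢a₀ (layer→root a' (a ⊕ ones) (sym (parity-Adj h)))))

    anchor : Σ (Cube k) (_≢ a₀)
    anchor with a₀ ≟ᶜ zeros
    ... | yes refl = ones , λ ones≡zeros → zeros≢ones (sym ones≡zeros)
    ... | no a₀≢0  = zeros , λ zeros≡a₀ → a₀≢0 (sym zeros≡a₀)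

    toAnchor : ∀ x → Outside x → WalkIn E⁺ Outside x (root (proj₁ anchor))
    toAnchor x out with reachRoot x out
    ... | a , a≢a₀ , x⇝a =
      x⇝a ++ᵂ bindᵂ root (λ a≢a₀ → a≢a₀) (λ u≢a₀ v≢a₀ (h , _) → rootsLinked u≢a₀ v≢a₀ h)
                      (noCutVertex a₀ a (proj₁ anchor) a≢a₀ (proj₂ anchor))

  module AvoidingVertex (v : Cube (suc k)) where
    open AvoidingLayer (layer v)

    outside : ∀ {x} → Outside x → x ≢ v
    outside out x≡v = out (cong layer x≡v)

    fromMember : ∀ x → x ≢ v → S⁺ x ≡ true → WalkIn E⁺ (_≢ v) x (root (proj₁ anchor))
    fromMember x x≢v x∈ with layer x ≟ᶜ layer v
    ... | no out = mapᵂ outside (toAnchor x out)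
    fromMember ⟨ a , b , p ⟩ x≢v x∈ | yes a≡a₀ with dominating (a ⊕ b)
    ... | w , h , _ = move x≢v (Adj-diffˡ h , inj₁ x∈) (mapᵂ outside (toAnchor _ w⊕b≢a₀))
      where
      w⊕b≢a₀ : w ⊕ b ≢ layer v
      w⊕b≢a₀ w⊕b≡a₀ = Adj⇒≢ (Adj-across h) (trans a≡a₀ (sym w⊕b≡a₀))

    toAnchorAvoiding : ∀ x → x ≢ v → WalkIn E⁺ (_≢ v) x (root (proj₁ anchor))
    toAnchorAvoiding x x≢v with S⁺ x in x∈
    ... | true  = fromMember x x≢v x∈
    ... | false with doublyDominating⁺ x x∈
    ...   | (y₁ , h₁ , y₁∈) , (y₂ , h₂ , y₂∈) , y₁≢y₂ with y₁ ≟ᶜ v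
    ...     | no y₁≢v  = move x≢v (h₁ , inj₂ y₁∈) (fromMember y₁ y₁≢v y₁∈)
    ...     | yes refl =
              move x≢v (h₂ , inj₂ y₂∈) (fromMember y₂ (λ y₂≡v → y₁≢y₂ (sym y₂≡v)) y₂∈)

  noCutVertex⁺ : ∀ v x y → x ≢ v → y ≢ v → WalkIn E⁺ (_≢ v) x y
  noCutVertex⁺ v x y x≢v y≢v =
    toAnchorAvoiding x x≢v ++ᵂ reverseᵂ CoverEdge-sym (toAnchorAvoiding y y≢v)
    where open AvoidingVertex v

  admissible⁺ : Admissible (suc k) S⁺
  admissible⁺ = record
    { zeros∈           = zeros∈⁺
    ; ones∈            = ones∈⁺
    ; dominating       = dominating⁺
    ; doublyDominating = doublyDominating⁺
    ; noCutVertex      = noCutVertex⁺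
    }

cover : ∀ k → Cube k → Bool
cover zero    = λ _ → true
cover (suc k) = double (cover k)

cover-admissible : ∀ k → Admissible k (cover k)
cover-admissible zero    = admissible₀
cover-admissible (suc k) = Doubling.admissible⁺ (cover-admissible k)

length-cartesianProductWith : ∀ {A B C : Set} (f : A → B → C) xs ys →
                              length (cartesianProductWith f xs ys) ≡ length xs * length ys
length-cartesianProductWith f []       ys = refl
length-cartesianProductWith f (x ∷ xs) ys =
  trans (length-++ (map (f x) ys))
        (cong₂ _+_ (length-map (f x) ys) (length-cartesianProductWith f xs ys))

bits : List Bool
bits = true ∷ false ∷ []

∈-bits : ∀ p → p ∈ bits
∈-bits true  = here refl
∈-bits false = there (here refl)

cubes : ∀ k → List (Cube k)
cubes zero    = map bit bits
cubes (suc k) =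
  cartesianProductWith (λ a (b , p) → ⟨ a , b , p ⟩) (cubes k) (cartesianProduct (cubes k) bits)

∈-cubes : ∀ (x : Cube k) → x ∈ cubes k
∈-cubes (bit p)       = ∈-map⁺ bit (∈-bits p)
∈-cubes ⟨ a , b , p ⟩ =
  ∈-cartesianProductWith⁺ _ (∈-cubes a) (∈-cartesianProduct⁺ (∈-cubes b) (∈-bits p))

length-cubes : ∀ k → length (cubes k) ≡ 2 ^ dim k
length-cubes zero    = refl
length-cubes (suc k) = begin
  length (cubes (suc k))
    ≡⟨ length-cartesianProductWith _ (cubes k) _ ⟩
  length (cubes k) * length (cartesianProduct (cubes k) bits)
    ≡⟨ cong (length (cubes k) *_) (length-cartesianProductWith _,_ (cubes k) bits) ⟩
  length (cubes k) * (length (cubes k) * 2)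
    ≡⟨ cong (λ n → n * (n * 2)) (length-cubes k) ⟩
  2 ^ dim k * (2 ^ dim k * 2 ^ 1)
    ≡⟨ cong (2 ^ dim k *_) (^-distribˡ-+-* 2 (dim k) 1) ⟨
  2 ^ dim k * 2 ^ (dim k + 1)
    ≡⟨ ^-distribˡ-+-* 2 (dim k) (dim k + 1) ⟨
  2 ^ dim (suc k)
    ∎
  where open ≡-Reasoning

coverExponent : ℕ → ℕ
coverExponent zero    = 1
coverExponent (suc k) = dim k + coverExponent k

coverList : ∀ k → List (Cube k)
coverList zero    = cubes zero
coverList (suc k) = cartesianProductWith (λ a w → ⟨ a , a ⊕ w , checkBit a w ⟩) (cubes k) (coverList k)

length-coverList : ∀ k → length (coverList k) ≡ 2 ^ coverExponent k
length-coverList zero    = refl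
length-coverList (suc k) = begin
  length (coverList (suc k))               ≡⟨ length-cartesianProductWith _ (cubes k) (coverList k) ⟩
  length (cubes k) * length (coverList k)  ≡⟨ cong₂ _*_ (length-cubes k) (length-coverList k) ⟩
  2 ^ dim k * 2 ^ coverExponent k          ≡⟨ ^-distribˡ-+-* 2 (dim k) (coverExponent k) ⟨
  2 ^ coverExponent (suc k)                ∎
  where open ≡-Reasoning

∈-coverList : ∀ k (x : Cube k) → cover k x ≡ true → x ∈ coverList k
∈-coverList zero    x _ = ∈-cubes x
∈-coverList (suc k) ⟨ a , b , p ⟩ x∈ with DoubleMembership.double-elim (cover k) x∈
... | w∈ , p≡c =
  subst (_∈ coverList (suc k)) (⟨⟩-cong refl (⊕-cancelˡ a b) (sym p≡c))
        (∈-cartesianProductWith⁺ _ (∈-cubes a) (∈-coverList k (a ⊕ b) w∈))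

flatten : Cube k → Vec Bool (dim k)
flatten (bit p)       = p ∷ []
flatten ⟨ a , b , p ⟩ = flatten a ++ flatten b ++ p ∷ []

flatten-injective : {x y : Cube k} → flatten x ≡ flatten y → x ≡ y
flatten-injective {x = bit p} {bit q} refl = refl
flatten-injective {x = ⟨ a , b , p ⟩} {⟨ a' , b' , p' ⟩} eq =
  ⟨⟩-cong (flatten-injective (++-injectiveˡ (flatten a) (flatten a') eq))
          (flatten-injective (++-injectiveˡ (flatten b) (flatten b') rest))
          (cong Vec.head (++-injectiveʳ (flatten b) (flatten b') rest))
  where
  rest = ++-injectiveʳ (flatten a) (flatten a') eq

flatten-surjective : ∀ k (u : Vec Bool (dim k)) → Σ (Cube k) λ x → flatten x ≡ u
flatten-surjective zero (p ∷ []) = bit p , refl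
flatten-surjective (suc k) u
  with ua , u′ , refl ← Vec.splitAt (dim k) u
  with ub , p ∷ [] , refl ← Vec.splitAt (dim k) u′
  with a , refl ← flatten-surjective k ua
  with b , refl ← flatten-surjective k ub
  = ⟨ a , b , p ⟩ , refl

data Adjᵛ : ∀ {n} → Vec Bool n → Vec Bool n → Set where
  atHead : ∀ {n x y} {xs : Vec Bool n} → x ≢ y → Adjᵛ (x ∷ xs) (y ∷ xs)
  inTail : ∀ {n x} {xs ys : Vec Bool n} → Adjᵛ xs ys → Adjᵛ (x ∷ xs) (x ∷ ys)

Adjᵛ⇒QAdj : ∀ {n} {u v : Vec Bool n} → Adjᵛ u v → QAdj n u v
Adjᵛ⇒QAdj (atHead x≢y) = fzero , x≢y , λ { fzero j≢0 → ⊥-elim (j≢0 refl) ; (fsuc j) _ → refl }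
Adjᵛ⇒QAdj (inTail h) with i , differs , agrees ← Adjᵛ⇒QAdj h =
  fsuc i , differs , λ { fzero _ → refl ; (fsuc j) j≢i → agrees j (λ j≡i → j≢i (cong fsuc j≡i)) }

Adjᵛ-++ˡ : ∀ {m n} {xs xs' : Vec Bool m} (ys : Vec Bool n) → Adjᵛ xs xs' → Adjᵛ (xs ++ ys) (xs' ++ ys)
Adjᵛ-++ˡ ys (atHead x≢y) = atHead x≢y
Adjᵛ-++ˡ ys (inTail h)   = inTail (Adjᵛ-++ˡ ys h)

Adjᵛ-++ʳ : ∀ {m n} (xs : Vec Bool m) {ys ys' : Vec Bool n} → Adjᵛ ys ys' → Adjᵛ (xs ++ ys) (xs ++ ys')
Adjᵛ-++ʳ []       h = h
Adjᵛ-++ʳ (x ∷ xs) h = inTail (Adjᵛ-++ʳ xs h)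

flatten-Adj : {x y : Cube k} → Adj x y → Adjᵛ (flatten x) (flatten y)
flatten-Adj flip₀ = atHead (not-¬ refl)
flatten-Adj {x = ⟨ a , b , p ⟩} (left h)  = Adjᵛ-++ˡ _ (flatten-Adj h)
flatten-Adj {x = ⟨ a , b , p ⟩} (right h) = Adjᵛ-++ʳ (flatten a) (Adjᵛ-++ˡ _ (flatten-Adj h))
flatten-Adj {x = ⟨ a , b , p ⟩} flip      =
  Adjᵛ-++ʳ (flatten a) (Adjᵛ-++ʳ (flatten b) (atHead (not-¬ refl)))

module _ {k} (S : Cube k → Bool) where

  coverGraph : SpanningSubgraph (dim k)
  coverGraph = record
    { Edge = λ u v → Σ (Cube k) λ x → Σ (Cube k) λ y → flatten x ≡ u × flatten y ≡ v × CoverEdge S x y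
    ; sym  = λ (x , y , x↦u , y↦v , e) → y , x , y↦v , x↦u , CoverEdge-sym {S = S} e
    ; ⊆Q   = λ { (_ , _ , refl , refl , h , _) → Adjᵛ⇒QAdj (flatten-Adj h) }
    }

  flattenWalk : ∀ {P : Cube k → Set} {Q : Vec Bool (dim k) → Set} → (∀ {x} → P x → Q (flatten x)) →
                ∀ {x y} → WalkIn (CoverEdge S) P x y → Walk coverGraph Q (flatten x) (flatten y)
  flattenWalk f (done px)                  = here (f px)
  flattenWalk f (move {x} {y} px e walk)   = step (f px) (x , y , refl , refl , e) (flattenWalk f walk)

  module _ (adm : Admissible k S) where
    open Admissible adm

    coverGraph-twoConnected : 2 < 2 ^ dim k → TwoConnected coverGraph
    coverGraph-twoConnected 2<2^d = 2<2^d , connected′ , noCutVertex′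
      where
      connected′ : Connected coverGraph
      connected′ u w
        with x , refl ← flatten-surjective k u
        with y , refl ← flatten-surjective k w
        = flattenWalk (λ _ → tt) (connected adm x y)

      noCutVertex′ : ∀ v u w → u ≢ v → w ≢ v → Walk coverGraph (_≢ v) u w
      noCutVertex′ v u w u≢v w≢v
        with z , refl ← flatten-surjective k v
        with x , refl ← flatten-surjective k u
        with y , refl ← flatten-surjective k w
        = flattenWalk (λ x≢z fx≡fz → x≢z (flatten-injective fx≡fz))
                      (noCutVertex z x y (λ x≡z → u≢v (cong flatten x≡z))
                                         (λ y≡z → w≢v (cong flatten y≡z)))

    coverGraph-TVC≤ : ∀ (L : List (Cube k)) → (∀ x → S x ≡ true → x ∈ L) → TVC≤ coverGraph (length L)
    coverGraph-TVC≤ L ⊇S =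
      map flatten L , (covers , totallyDominates) , ≤-reflexive (length-map flatten L)
      where
      covers : ∀ u v → Edge coverGraph u v → u ∈ map flatten L ⊎ v ∈ map flatten L
      covers _ _ (x , _ , refl , refl , _ , inj₁ x∈) = inj₁ (∈-map⁺ flatten (⊇S x x∈))
      covers _ _ (_ , y , refl , refl , _ , inj₂ y∈) = inj₂ (∈-map⁺ flatten (⊇S y y∈))

      totallyDominates : ∀ v → Σ (Vec Bool (dim k)) λ u → u ∈ map flatten L × Edge coverGraph v u
      totallyDominates v with x , refl ← flatten-surjective k v with y , h , y∈ ← dominating x =
        flatten y , ∈-map⁺ flatten (⊇S y y∈) , x , y , refl , refl , h , inj₂ y∈

-- Arithmetic of the exponents

suc-dim : ∀ k → suc (dim k) ≡ 2 ^ suc k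
suc-dim zero    = refl
suc-dim (suc k) = begin
  suc (dim k + (dim k + 1))      ≡⟨ cong (λ n → suc (dim k + n)) (+-comm (dim k) 1) ⟩
  suc (dim k) + suc (dim k)      ≡⟨ cong (λ n → n + n) (suc-dim k) ⟩
  2 ^ suc k + 2 ^ suc k          ≡⟨ cong (2 ^ suc k +_) (+-identityʳ (2 ^ suc k)) ⟨
  2 ^ suc (suc k)                ∎
  where open ≡-Reasoning

coverExponent-+ : ∀ k → coverExponent k + k ≡ dim k
coverExponent-+ zero    = refl
coverExponent-+ (suc k) = begin
  dim k + coverExponent k + suc k    ≡⟨ +-assoc (dim k) (coverExponent k) (suc k) ⟩
  dim k + (coverExponent k + suc k)  ≡⟨ cong (dim k +_) (+-suc (coverExponent k) k) ⟩
  dim k + suc (coverExponent k + k)  ≡⟨ cong (λ n → dim k + suc n) (coverExponent-+ k) ⟩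
  dim k + suc (dim k)                ≡⟨ cong (dim k +_) (+-comm 1 (dim k)) ⟩
  dim (suc k)                        ∎
  where open ≡-Reasoning

1≤coverExponent : ∀ k → 1 ≤ coverExponent k
1≤coverExponent zero    = ≤-refl
1≤coverExponent (suc k) = ≤-trans (1≤coverExponent k) (m≤n+m _ (dim k))

2≤dim : ∀ k → 2 ≤ dim (suc k)
2≤dim k = subst (2 ≤_) (coverExponent-+ (suc k)) (+-mono-≤ (1≤coverExponent (suc k)) (s≤s z≤n))

[m+n]∸[1+n]+1≡m : ∀ {m} n → 1 ≤ m → m + n ∸ suc n + 1 ≡ m
[m+n]∸[1+n]+1≡m {suc r} n _ = trans (cong (_+ 1) (m+n∸n≡m r n)) (+-comm r 1)

dim∸[1+k]+1≡coverExponent : ∀ k → dim k ∸ suc k + 1 ≡ coverExponent k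
dim∸[1+k]+1≡coverExponent k =
  subst (λ d → d ∸ suc k + 1 ≡ coverExponent k) (coverExponent-+ k)
        ([m+n]∸[1+n]+1≡m k (1≤coverExponent k))

theorem4p6 : (ℓ d : ℕ) → 2 ≤ ℓ → d ≡ 2 ^ ℓ ∸ 1 →
    Σ (SpanningSubgraph d) λ H → TwoConnected H ×
      Σ ℕ λ t → TVC≤ H t ×
        ((t ∸ 2 ^ (d ∸ ℓ + 1)) ^ 2 ≤ 2 ^ (d + 2 ∸ 2 * ℓ))
theorem4p6 (suc k@(suc m)) d (s≤s (s≤s z≤n)) d≡2^ℓ∸1
  with refl ← trans d≡2^ℓ∸1 (cong (_∸ 1) (sym (suc-dim k))) =
  coverGraph (cover k) ,
  coverGraph-twoConnected (cover k) admissible (^-monoʳ-< 2 (s≤s (s≤s z≤n)) (2≤dim m)) ,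
  2 ^ coverExponent k ,
  subst (TVC≤ (coverGraph (cover k))) (length-coverList k)
        (coverGraph-TVC≤ (cover k) admissible (coverList k) (∈-coverList k)) ,
  excess≤
  where
  admissible : Admissible k (cover k)
  admissible = cover-admissible k

  excess≤ : (2 ^ coverExponent k ∸ 2 ^ (dim k ∸ suc k + 1)) ^ 2 ≤ 2 ^ (dim k + 2 ∸ 2 * suc k)
  excess≤ rewrite dim∸[1+k]+1≡coverExponent k | n∸n≡0 (2 ^ coverExponent k) = z≤n
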